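{- Let $G=(V,E)$ be a finite simple graph. Then \[ir_{cy}(G)\leq \gamma_{cy}(G)\leq i_{cy}(G)\leq \beta_{cy}(G)\leq \Gamma_{cy}(G)\leq IR_{cy}(G).\]
   Context: For $S\subseteq V$, $\langle S\rangle$ denotes the subgraph of $G$ induced by $S$. Maximal/minimal are with respect to set inclusion. A set $S\subseteq V$ is cycle independent if $\langle S\rangle$ is acyclic. $\beta_{cy}(G)$ is the maximum size of a cycle independent set; $i_{cy}(G)$ is the minimum size of a maximal cycle independent set. A set $S\subseteq V$ is cycle dominating if for every $u\in V\setminus S$ there is a cycle in $\langle S\cup\{u\}\rangle$ containing $u$. $\gamma_{cy}(G)$ is the minimum size of a cycle dominating set; $\Gamma_{cy}(G)$ is the maximum size of a minimal cycle dominating set. A set $S\subseteq V$ is cycle irredundant if for every $u\in S$, either $u$ is not contained in any cycle of $\langle S\rangle$, or there exists $v\in V\setminus S$ such that $v$ is contained in a cycle of $\langle S\cup\{v\}\rangle$ but $v$ is not contained in any cycle of $\langle (S\setminus\{u\})\cup\{v\}\rangle$. $IR_{cy}(G)$ is the maximum size of a cycle irredundant set; $ir_{cy}(G)$ is the minimum size of a maximal cycle irredundant set (a cycle irredundant set with no cycle irredundant proper superset). -}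

module Defs where

open import Data.Nat using (ℕ; _≤_; _≥_)
open import Data.Bool using (Bool; true; false)
open import Data.Fin using (Fin)
open import Data.Fin.Subset using (Subset; _∈_; _∉_; _⊂_; _∪_; _─_; ⁅_⁆; ∣_∣)
open import Data.List using (List; []; _∷_; length; head)
open import Data.List.Relation.Unary.All using (All)
open import Data.List.Relation.Unary.Unique.Propositional using (Unique)
import Data.List.Membership.Propositional as LM
open import Data.Maybe using (Maybe; just; nothing)
open import Data.Product using (Σ; ∃; _×_; _,_)
open import Data.Sum using (_⊎_)
open import Data.Unit using (⊤)
open import Relation.Nullary using (¬_)
open import Relation.Binary.PropositionalEquality using (_≡_)

record Graph (n : ℕ) : Set where
  field
    edge  : Fin n → Fin n → Bool
    sym   : ∀ i j → edge i j ≡ edge j i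
    irrefl : ∀ i → edge i i ≡ false

module _ {n : ℕ} (G : Graph n) where
  open Graph G

  Adj : Fin n → Fin n → Set
  Adj i j = edge i j ≡ true

  ClosedWalkFrom : Fin n → List (Fin n) → Set
  ClosedWalkFrom first [] = ⊤
  ClosedWalkFrom first (x ∷ []) = Adj x first
  ClosedWalkFrom first (x ∷ y ∷ xs) = Adj x y × ClosedWalkFrom first (y ∷ xs)

  IsCycleList : List (Fin n) → Set
  IsCycleList [] = ⊤ -- excluded by length ≥ 3 below
  IsCycleList (x ∷ xs) = ClosedWalkFrom x (x ∷ xs)

  record Cycle (S : Subset n) : Set where
    field
      verts    : List (Fin n)
      long     : length verts ≥ 3
      distinct : Unique verts
      inS      : All (_∈ S) verts
      closed   : IsCycleList verts

  OnCycle : Subset n → Fin n → Set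
  OnCycle S u = Σ (Cycle S) (λ C → u LM.∈ Cycle.verts C)

  CycleIndependent : Subset n → Set
  CycleIndependent S = ¬ Cycle S

  MaximalCycleIndependent : Subset n → Set
  MaximalCycleIndependent S =
    CycleIndependent S × (∀ T → S ⊂ T → ¬ CycleIndependent T)

  CycleDominating : Subset n → Set
  CycleDominating S = ∀ u → u ∉ S → OnCycle (S ∪ ⁅ u ⁆) u

  MinimalCycleDominating : Subset n → Set
  MinimalCycleDominating S =
    CycleDominating S × (∀ T → T ⊂ S → ¬ CycleDominating T)

  CycleIrredundant : Subset n → Set
  CycleIrredundant S =
    ∀ u → u ∈ S →
      ¬ OnCycle S u
      ⊎ ∃ (λ v → v ∉ S × OnCycle (S ∪ ⁅ v ⁆) v
                       × ¬ OnCycle ((S ─ ⁅ u ⁆) ∪ ⁅ v ⁆) v)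

  MaximalCycleIrredundant : Subset n → Set
  MaximalCycleIrredundant S =
    CycleIrredundant S × (∀ T → S ⊂ T → ¬ CycleIrredundant T)

IsMinSize : {n : ℕ} → (Subset n → Set) → ℕ → Set
IsMinSize P k = ∃ (λ S → P S × ∣ S ∣ ≡ k) × (∀ S → P S → k ≤ ∣ S ∣)

IsMaxSize : {n : ℕ} → (Subset n → Set) → ℕ → Set
IsMaxSize P k = ∃ (λ S → P S × ∣ S ∣ ≡ k) × (∀ S → P S → ∣ S ∣ ≤ k)

module _ {n : ℕ} (G : Graph n) where
  ir-cy γ-cy i-cy β-cy Γ-cy IR-cy : ℕ → Set
  ir-cy = IsMinSize (MaximalCycleIrredundant G)
  γ-cy  = IsMinSize (CycleDominating G)
  i-cy  = IsMinSize (MaximalCycleIndependent G)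
  β-cy  = IsMaxSize (CycleIndependent G)
  Γ-cy  = IsMaxSize (MinimalCycleDominating G)
  IR-cy = IsMaxSize (CycleIrredundant G)

-- The chain comes from three implications between extremal sets: a maximal
-- cycle independent set is a minimal cycle dominating set, and a minimal cycle
-- dominating set is a maximal cycle irredundant set; moreover a minimum cycle
-- dominating set is minimal and a maximum cycle independent set is maximal.
-- Two of the implications need to decide whether a vertex lies on a cycle of
-- an induced subgraph, which is possible because a cycle has at most n
-- distinct vertices, so only finitely many lists need to be searched.
module Submission where

open import Defs
open import Data.Nat using (ℕ; _≤_)
open import Data.Product using (_×_)

open import Data.Nat using (zero; suc; z≤n; s≤s; _≤?_)
open import Data.Nat.Properties using (<⇒≱)
open import Data.Bool using (true)
import Data.Bool.Properties as Bool
open import Data.Fin using (Fin; zero; suc)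
open import Data.Fin.Properties using (_≟_; any?; ¬∀⟶∃¬; injective⇒≤)
open import Data.Fin.Subset using (Subset; _∈_; _∉_; _⊂_; _⊆_; _∪_; _-_; ⁅_⁆; ∣_∣)
open import Data.Fin.Subset.Properties
  using (_∈?_; p⊂q⇒∣p∣<∣q∣; x∈⁅x⁆; x∈⁅y⁆⇒x≡y; p⊆p∪q; q⊆p∪q; x∈p∪q⁻;
         x∈p∧x≢y⇒x∈p-y; x∈p⇒p-x⊂p)
open import Data.List using (List; []; _∷_; length; lookup)
open import Data.List.Relation.Unary.All as All using (All)
import Data.List.Relation.Unary.AllPairs as AllPairs
open import Data.List.Relation.Unary.Unique.Propositional using (Unique)
open import Data.List.Relation.Unary.Unique.Propositional.Properties using (Unique[x∷xs]⇒x∉xs)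
import Data.List.Relation.Unary.Unique.DecPropositional as UniqueDec
open import Data.List.Membership.Propositional using () renaming (_∈_ to _∈ₗ_)
open import Data.List.Membership.Propositional.Properties using (∈-lookup)
import Data.List.Membership.DecPropositional as MembershipDec
open import Data.Product using (∃; _,_; proj₁)
open import Data.Sum using (_⊎_; inj₁; inj₂)
open import Data.Unit using (tt)
open import Data.Empty using (⊥-elim)
open import Function using (_∘_)
open import Function.Definitions using (Injective)
open import Relation.Nullary using (¬_; Dec; yes; no; contradiction)
open import Relation.Nullary.Decidable using (_×-dec_; _⊎-dec_; _→-dec_; map′; ¬?; decidable-stable)
open import Relation.Unary using (Decidable)
open import Relation.Binary.PropositionalEquality using (_≡_; refl; sym; subst; cong)

p⊆p-x∪⁅x⁆ : ∀ {m} (p : Subset m) (x : Fin m) → p ⊆ (p - x) ∪ ⁅ x ⁆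
p⊆p-x∪⁅x⁆ p x {y} y∈p with y ≟ x
... | yes refl = q⊆p∪q (p - x) ⁅ x ⁆ (x∈⁅x⁆ x)
... | no y≢x  = p⊆p∪q ⁅ x ⁆ (x∈p∧x≢y⇒x∈p-y y∈p y≢x)

x∈p∧x∉p-y⇒x≡y : ∀ {m} {p : Subset m} {x y : Fin m} → x ∈ p → x ∉ p - y → x ≡ y
x∈p∧x∉p-y⇒x≡y {x = x} {y} x∈p x∉p-y =
  decidable-stable (x ≟ y) (x∉p-y ∘ x∈p∧x≢y⇒x∈p-y x∈p)

Unique⇒lookup-injective : ∀ {A : Set} {xs : List A} → Unique xs → Injective _≡_ _≡_ (lookup xs)
Unique⇒lookup-injective {xs = x ∷ xs} _ {zero} {zero} _ = refl
Unique⇒lookup-injective {xs = x ∷ xs} u {zero} {suc j} eq =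
  contradiction (subst (_∈ₗ xs) (sym eq) (∈-lookup j)) (Unique[x∷xs]⇒x∉xs u)
Unique⇒lookup-injective {xs = x ∷ xs} u {suc i} {zero} eq =
  contradiction (subst (_∈ₗ xs) eq (∈-lookup i)) (Unique[x∷xs]⇒x∉xs u)
Unique⇒lookup-injective {xs = x ∷ xs} (_ AllPairs.∷ u) {suc i} {suc j} eq =
  cong suc (Unique⇒lookup-injective u eq)

Unique⇒length≤ : ∀ {n} {xs : List (Fin n)} → Unique xs → length xs ≤ n
Unique⇒length≤ u = injective⇒≤ (Unique⇒lookup-injective u)

∃-boundedList? : ∀ {n p} {P : List (Fin n) → Set p} → Decidable P →
                 ∀ k → Dec (∃ λ xs → length xs ≤ k × P xs)
∃-boundedList? P? zero = map′ (λ P[] → [] , z≤n , P[]) (λ { ([] , _ , P[]) → P[] }) (P? [])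
∃-boundedList? {P = P} P? (suc k) =
  map′ to from (P? [] ⊎-dec any? (λ x → ∃-boundedList? (P? ∘ (x ∷_)) k))
  where
  to : P [] ⊎ ∃ (λ x → ∃ λ xs → length xs ≤ k × P (x ∷ xs)) → ∃ λ xs → length xs ≤ suc k × P xs
  to (inj₁ P[])                     = [] , z≤n , P[]
  to (inj₂ (x , xs , len , Px∷xs)) = x ∷ xs , s≤s len , Px∷xs
  from : (∃ λ xs → length xs ≤ suc k × P xs) → P [] ⊎ ∃ (λ x → ∃ λ xs → length xs ≤ k × P (x ∷ xs))
  from ([] , _ , P[])             = inj₁ P[]
  from (x ∷ xs , s≤s len , Px∷xs) = inj₂ (x , xs , len , Px∷xs)

module _ {n : ℕ} (G : Graph n) where
  open Graph G using (edge)

  Cycle-restrict : ∀ {S} T (C : Cycle G S) → All (_∈ T) (Cycle.verts C) → Cycle G T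
  Cycle-restrict T C inT = record
    { verts = Cycle.verts C ; long = Cycle.long C ; distinct = Cycle.distinct C
    ; inS = inT ; closed = Cycle.closed C }

  Cycle-mono : ∀ {S T} → S ⊆ T → Cycle G S → Cycle G T
  Cycle-mono {T = T} S⊆T C = Cycle-restrict T C (All.map S⊆T (Cycle.inS C))

  OnCycle-mono : ∀ {S T u} → S ⊆ T → OnCycle G S u → OnCycle G T u
  OnCycle-mono S⊆T (C , u∈C) = Cycle-mono S⊆T C , u∈C

  Cycle-∪⁅⁆ : ∀ {S u} → Cycle G (S ∪ ⁅ u ⁆) → OnCycle G (S ∪ ⁅ u ⁆) u ⊎ Cycle G S
  Cycle-∪⁅⁆ {S} {u} C with MembershipDec._∈?_ _≟_ u (Cycle.verts C)
  ... | yes u∈C = inj₁ (C , u∈C)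
  ... | no  u∉C = inj₂ (Cycle-restrict S C (All.tabulate inS))
    where
    inS : ∀ {x} → x ∈ₗ Cycle.verts C → x ∈ S
    inS {x} x∈C with x∈p∪q⁻ S ⁅ u ⁆ (All.lookup (Cycle.inS C) x∈C)
    ... | inj₁ x∈S   = x∈S
    ... | inj₂ x∈⁅u⁆ = contradiction (subst (_∈ₗ Cycle.verts C) (x∈⁅y⁆⇒x≡y u x∈⁅u⁆) x∈C) u∉C

  ClosedWalkFrom? : ∀ first xs → Dec (ClosedWalkFrom G first xs)
  ClosedWalkFrom? first []           = yes tt
  ClosedWalkFrom? first (x ∷ [])     = edge x first Bool.≟ true
  ClosedWalkFrom? first (x ∷ y ∷ xs) = (edge x y Bool.≟ true) ×-dec ClosedWalkFrom? first (y ∷ xs)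

  IsCycleList? : ∀ xs → Dec (IsCycleList G xs)
  IsCycleList? []       = yes tt
  IsCycleList? (x ∷ xs) = ClosedWalkFrom? x (x ∷ xs)

  CycleListThrough : Subset n → Fin n → List (Fin n) → Set
  CycleListThrough S u xs =
    3 ≤ length xs × Unique xs × All (_∈ S) xs × IsCycleList G xs × u ∈ₗ xs

  CycleListThrough? : ∀ S u → Decidable (CycleListThrough S u)
  CycleListThrough? S u xs =
    (3 ≤? length xs) ×-dec UniqueDec.unique? _≟_ xs ×-dec All.all? (_∈? S) xs
      ×-dec IsCycleList? xs ×-dec MembershipDec._∈?_ _≟_ u xs

  OnCycle? : ∀ S u → Dec (OnCycle G S u)
  OnCycle? S u = map′ to from (∃-boundedList? (CycleListThrough? S u) n)
    where
    to : (∃ λ xs → length xs ≤ n × CycleListThrough S u xs) → OnCycle G S u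
    to (xs , _ , long , distinct , inS , closed , u∈xs) =
      record { verts = xs ; long = long ; distinct = distinct ; inS = inS ; closed = closed } , u∈xs
    from : OnCycle G S u → ∃ λ xs → length xs ≤ n × CycleListThrough S u xs
    from (C , u∈C) = Cycle.verts C , Unique⇒length≤ (Cycle.distinct C)
      , Cycle.long C , Cycle.distinct C , Cycle.inS C , Cycle.closed C , u∈C

  ¬CycleDominating⇒∃undominated : ∀ {S} → ¬ CycleDominating G S →
                                  ∃ λ v → v ∉ S × ¬ OnCycle G (S ∪ ⁅ v ⁆) v
  ¬CycleDominating⇒∃undominated {S} ¬dom
    with v , ¬dominated ← ¬∀⟶∃¬ n _ (λ v → ¬? (v ∈? S) →-dec OnCycle? (S ∪ ⁅ v ⁆) v) ¬dom
    = v , (λ v∈S → ¬dominated (λ v∉S → contradiction v∈S v∉S)) , (λ oc → ¬dominated (λ _ → oc))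

  maximalIndependent⇒dominating : ∀ {S} → MaximalCycleIndependent G S → CycleDominating G S
  maximalIndependent⇒dominating {S} (indep , maximal) u u∉S with OnCycle? (S ∪ ⁅ u ⁆) u
  ... | yes onCycle = onCycle
  ... | no ¬onCycle = ⊥-elim (maximal (S ∪ ⁅ u ⁆) S⊂S∪⁅u⁆ S∪⁅u⁆-independent)
    where
    S⊂S∪⁅u⁆ : S ⊂ S ∪ ⁅ u ⁆
    S⊂S∪⁅u⁆ = p⊆p∪q ⁅ u ⁆ , u , q⊆p∪q S ⁅ u ⁆ (x∈⁅x⁆ u) , u∉S
    S∪⁅u⁆-independent : CycleIndependent G (S ∪ ⁅ u ⁆)
    S∪⁅u⁆-independent C with Cycle-∪⁅⁆ C
    ... | inj₁ onCycle = ¬onCycle onCycle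
    ... | inj₂ cycleInS = indep cycleInS

  maximalIndependent⇒minimalDominating : ∀ {S} → MaximalCycleIndependent G S → MinimalCycleDominating G S
  maximalIndependent⇒minimalDominating {S} maxIndep@(indep , _) =
    maximalIndependent⇒dominating maxIndep , λ where
      T (T⊆S , w , w∈S , w∉T) domT → indep (proj₁ (OnCycle-mono (T∪⁅w⁆⊆S T⊆S w∈S) (domT w w∉T)))
    where
    T∪⁅w⁆⊆S : ∀ {T w} → T ⊆ S → w ∈ S → T ∪ ⁅ w ⁆ ⊆ S
    T∪⁅w⁆⊆S {T} {w} T⊆S w∈S x∈ with x∈p∪q⁻ T ⁅ w ⁆ x∈
    ... | inj₁ x∈T   = T⊆S x∈T
    ... | inj₂ x∈⁅w⁆ = subst (_∈ S) (sym (x∈⁅y⁆⇒x≡y w x∈⁅w⁆)) w∈S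

  -- If u lies on a cycle of ⟨S⟩, then the vertex left undominated by S - u
  -- is the private witness demanded by irredundance: it cannot be u itself.
  minimalDominating⇒irredundant : ∀ {S} → MinimalCycleDominating G S → CycleIrredundant G S
  minimalDominating⇒irredundant {S} (dom , minimal) u u∈S with OnCycle? S u
  ... | no ¬onCycle = inj₁ ¬onCycle
  ... | yes onCycle
    with v , v∉S-u , ¬onCycle-v ← ¬CycleDominating⇒∃undominated (minimal (S - u) (x∈p⇒p-x⊂p u∈S))
    with v ∈? S
  ... | no v∉S = inj₂ (v , v∉S , dom v v∉S , ¬onCycle-v)
  ... | yes v∈S with refl ← x∈p∧x∉p-y⇒x≡y v∈S v∉S-u =
    ⊥-elim (¬onCycle-v (OnCycle-mono (p⊆p-x∪⁅x⁆ S u) onCycle))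

  minimalDominating⇒maximalIrredundant : ∀ {S} → MinimalCycleDominating G S → MaximalCycleIrredundant G S
  minimalDominating⇒maximalIrredundant {S} minDom@(dom , _) =
    minimalDominating⇒irredundant minDom , noIrredundantSuperset
    where
    noIrredundantSuperset : ∀ T → S ⊂ T → ¬ CycleIrredundant G T
    noIrredundantSuperset T (S⊆T , w , w∈T , w∉S) irr with irr w w∈T
    ... | inj₁ ¬onCycle = ¬onCycle (OnCycle-mono S∪⁅w⁆⊆T (dom w w∉S))
      where
      S∪⁅w⁆⊆T : S ∪ ⁅ w ⁆ ⊆ T
      S∪⁅w⁆⊆T x∈ with x∈p∪q⁻ S ⁅ w ⁆ x∈
      ... | inj₁ x∈S   = S⊆T x∈S
      ... | inj₂ x∈⁅w⁆ = subst (_∈ T) (sym (x∈⁅y⁆⇒x≡y w x∈⁅w⁆)) w∈T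
    ... | inj₂ (v , v∉T , _ , ¬onCycle) = ¬onCycle (OnCycle-mono S∪⁅v⁆⊆T-w∪⁅v⁆ (dom v (v∉T ∘ S⊆T)))
      where
      S∪⁅v⁆⊆T-w∪⁅v⁆ : S ∪ ⁅ v ⁆ ⊆ (T - w) ∪ ⁅ v ⁆
      S∪⁅v⁆⊆T-w∪⁅v⁆ x∈ with x∈p∪q⁻ S ⁅ v ⁆ x∈
      ... | inj₂ x∈⁅v⁆ = q⊆p∪q (T - w) ⁅ v ⁆ x∈⁅v⁆
      ... | inj₁ x∈S   = p⊆p∪q ⁅ v ⁆ (x∈p∧x≢y⇒x∈p-y (S⊆T x∈S) λ { refl → w∉S x∈S })

module _ {n : ℕ} {P : Subset n → Set} {k : ℕ} where

  IsMinSize⇒minimal : IsMinSize P k → ∀ {S} → P S → ∣ S ∣ ≡ k → ∀ T → T ⊂ S → ¬ P T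
  IsMinSize⇒minimal (_ , k≤) _ refl T T⊂S PT = <⇒≱ (p⊂q⇒∣p∣<∣q∣ T⊂S) (k≤ T PT)

  IsMaxSize⇒maximal : IsMaxSize P k → ∀ {S} → P S → ∣ S ∣ ≡ k → ∀ T → S ⊂ T → ¬ P T
  IsMaxSize⇒maximal (_ , ≤k) _ refl T S⊂T PT = <⇒≱ (p⊂q⇒∣p∣<∣q∣ S⊂T) (≤k T PT)

mainTheorem1 : (n : ℕ) (G : Graph n) (a b c d e f : ℕ) →
    ir-cy G a → γ-cy G b → i-cy G c → β-cy G d → Γ-cy G e → IR-cy G f →
    a ≤ b × b ≤ c × c ≤ d × d ≤ e × e ≤ f
mainTheorem1 n G a b c d e f
  (_ , a≤) γ@((Sb , domB , refl) , b≤) ((Sc , maxIndC , refl) , _)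
  β@((Sd , indD , refl) , ≤d) ((Se , minDomE , refl) , ≤e) (_ , ≤f) =
  a≤ Sb (minimalDominating⇒maximalIrredundant G minDomB) ,
  b≤ Sc (maximalIndependent⇒dominating G maxIndC) ,
  ≤d Sc (proj₁ maxIndC) ,
  ≤e Sd (maximalIndependent⇒minimalDominating G maxIndD) ,
  ≤f Se (minimalDominating⇒irredundant G minDomE)
  where
  minDomB : MinimalCycleDominating G Sb
  minDomB = domB , IsMinSize⇒minimal γ domB refl
  maxIndD : MaximalCycleIndependent G Sd
  maxIndD = indD , IsMaxSize⇒maximal β indD refl
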